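{- Let $M$ be a binary matroid of rank $n$ with a surjective $n$-colouring $c$ having colour classes $X_1,\dots,X_n$. If $(M,c)$ is circuit-achromatic, then (i) for some $i$, the elements of $X_i$ form a parallel class of $M$, and (ii) for some $i$, $X_i$ is a cocircuit of $M$.
   Context: An $n$-colouring of $M$ is a function $c:E(M)\to[n]$ with colour classes $X_i=c^{ -1}(i)$. $(M,c)$ is circuit-achromatic if no circuit of $M$ has pairwise distinct colours on its elements. -}

module Defs where

open import Data.Nat using (ℕ; _≤_)
open import Data.Bool using (Bool; true; false; _xor_; if_then_else_)
open import Data.Fin using (Fin; _≟_)
open import Data.Fin.Subset using (Subset; _∈_; _∉_; _⊆_; _⊂_; _∩_; _∪_; ⁅_⁆; ∣_∣; Nonempty; Empty)
open import Data.Vec using (Vec; replicate; zipWith; lookup; tabulate)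
open import Data.List using (foldr; allFin)
open import Data.Product using (Σ; ∃; _×_)
open import Relation.Nullary using (¬_)
open import Relation.Nullary.Decidable using (⌊_⌋)
open import Relation.Binary.PropositionalEquality using (_≡_; _≢_)

-- A binary matroid on ground set E = Fin m, given by a representation over
-- GF(2): element e is the column vector (A e) ∈ GF(2)^k (Bool with xor = +).
BinRep : ℕ → ℕ → Set
BinRep m k = Fin m → Vec Bool k

module _ {m k : ℕ} (A : BinRep m k) where

  sumCols : Subset m → Vec Bool k
  sumCols S = foldr (λ e acc → if lookup S e then zipWith _xor_ (A e) acc else acc)
                    (replicate k false) (allFin m)

  -- S is (linearly) dependent over GF(2): a nontrivial GF(2)-combination
  -- (= a nonempty subset) of its columns sums to zero.
  Dependent : Subset m → Set
  Dependent S = ∃ λ T → T ⊆ S × Nonempty T × sumCols T ≡ replicate k false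

  Independent : Subset m → Set
  Independent S = ¬ Dependent S

  Circuit : Subset m → Set
  Circuit C = Dependent C × (∀ T → T ⊂ C → Independent T)

  Basis : Subset m → Set
  Basis B = Independent B × (∀ e → e ∉ B → Dependent (B ∪ ⁅ e ⁆))

  HasRank : ℕ → Set
  HasRank r = (∃ λ B → Independent B × ∣ B ∣ ≡ r)
            × (∀ S → Independent S → ∣ S ∣ ≤ r)

  Loop : Fin m → Set
  Loop e = Circuit ⁅ e ⁆

  -- distinct e, f are parallel iff {e,f} is a circuit
  -- parallel class: an equivalence class of the parallel relation on non-loops
  -- (x ~ y iff x = y or {x,y} is a circuit)
  ParallelClass : Subset m → Set
  ParallelClass P = Nonempty P
                  × (∀ e → e ∈ P → ¬ Loop e)
                  × (∀ e f → e ∈ P → f ∈ P → e ≢ f → Circuit (⁅ e ⁆ ∪ ⁅ f ⁆))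
                  × (∀ e f → e ∈ P → f ∉ P → ¬ Circuit (⁅ e ⁆ ∪ ⁅ f ⁆))

  Cocircuit : Subset m → Set
  Cocircuit D = (∀ B → Basis B → Nonempty (D ∩ B))
              × (∀ D′ → D′ ⊂ D → ∃ λ B → Basis B × Empty (D′ ∩ B))

Surjective : {m n : ℕ} → (Fin m → Fin n) → Set
Surjective {m} {n} c = ∀ (i : Fin n) → ∃ λ (e : Fin m) → c e ≡ i

ColourClass : {m n : ℕ} → (Fin m → Fin n) → Fin n → Subset m
ColourClass c i = tabulate (λ e → ⌊ c e ≟ i ⌋)

CircuitAchromatic : {m k n : ℕ} → BinRep m k → (Fin m → Fin n) → Set
CircuitAchromatic A c =
  ∀ C → Circuit A C → ¬ (∀ e f → e ∈ C → f ∈ C → c e ≡ c f → e ≡ f)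

{-# OPTIONS --safe #-}
module Submission where

-- A rainbow set (no two elements of one colour) contains no circuit, so it is independent; hence
-- every transversal g (one element g i of each colour i) is a basis.  Fix one, b, and give every
-- element e its coordinates coords e ⊆ [n] with respect to b.  Trading the elements of b on a set
-- L of colours for those of another transversal g keeps a basis, and this forces the coordinate
-- sum of g over L to meet L.  Draw an edge i → j between colours when some element of colour j
-- has coordinate i.  If every colour i of a set K had an edge to some f i receiving no other edge
-- from K, the coordinate sum over f(K) of the corresponding elements would miss f(K); so every set
-- of colours has a source, and then also a sink.  For a source j every element of colour j has
-- coordinates {j}, i.e. is parallel to b j, and the colour class is a parallel class.  For a sink
-- s no element of another colour has coordinate s, so every basis meets the colour class of s,
-- while a transversal through any of its elements avoids the rest: it is a cocircuit.

open import Defs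
open import Data.Bool using (Bool; true; false; _xor_; _∧_; if_then_else_)
open import Data.Bool.Properties
  using (xor-assoc; xor-comm; xor-same; xor-identityˡ; xor-identityʳ; ∧-distribˡ-xor; T-≡)
  renaming (_≟_ to _≟ᵇ_)
open import Data.Empty using (⊥; ⊥-elim)
open import Data.Fin using (Fin; zero; suc; _≟_)
open import Data.Fin.Properties using (any?; all?; suc-injective; 0≢1+n)
open import Data.Fin.Subset
  using (Subset; _∈_; _∉_; _⊆_; _⊂_; _∩_; _∪_; _-_; ⁅_⁆; ∣_∣; Nonempty; Empty; ⊤)
  renaming (⊥ to ∅)
open import Data.Fin.Subset.Induction using (⊂-wellFounded; Acc; acc)
open import Data.Fin.Subset.Properties
  using (_∈?_; _⊆?_; nonempty?; anySubset?; drop-there; drop-∷-Empty; ∈⊤; ⊆-refl; ⊆-trans;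
         ⊆-antisym; x∈⁅x⁆; x∈⁅y⁆⇒x≡y; x∈p∪q⁺; x∈p∪q⁻; x∈p∩q⁺; x∈p∩q⁻; p─q⊆p;
         x∈p∧x≢y⇒x∈p-y; x∈p⇒p-x⊂p; x∈p⇒∣p-x∣<∣p∣)
open import Data.List using (allFin)
open import Data.List.Properties using (foldr-map; map-tabulate)
open import Data.Nat using (ℕ; zero; suc; _≤_; _<_; z≤n; s≤s)
open import Data.Nat.Properties using (≤-trans; <⇒≱)
open import Data.Product using (Σ; ∃; _×_; _,_; proj₁; proj₂; map₂)
open import Data.Sum using (_⊎_; inj₁; inj₂)
open import Data.Vec using (Vec; []; _∷_; replicate; zipWith; lookup; tabulate; head; here; there)
open import Data.Vec.Properties
  using (zipWith-assoc; zipWith-identityˡ; zipWith-identityʳ; lookup-zipWith; lookup∘tabulate;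
         tabulate∘lookup; tabulate-cong; []=⇒lookup; lookup⇒[]=; ≡-dec)
open import Function using (_∘_; id; const)
open import Function.Bundles using (Equivalence)
open import Relation.Binary using (Decidable)
open import Relation.Binary.PropositionalEquality
open import Relation.Nullary using (¬_; Dec; yes; no)
open import Relation.Nullary.Decidable using (⌊_⌋; _×-dec_; _→-dec_; ¬?; toWitness; fromWitness)

infixl 6 _+ᵥ_

_+ᵥ_ : ∀ {k} → Vec Bool k → Vec Bool k → Vec Bool k
_+ᵥ_ = zipWith _xor_

0ᵥ : ∀ {k} → Vec Bool k
0ᵥ = replicate _ false

_·_ : ∀ {k} → Bool → Vec Bool k → Vec Bool k
x · u = if x then u else 0ᵥ

+ᵥ-assoc : ∀ {k} (u v w : Vec Bool k) → u +ᵥ v +ᵥ w ≡ u +ᵥ (v +ᵥ w)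
+ᵥ-assoc = zipWith-assoc xor-assoc

+ᵥ-identityˡ : ∀ {k} (u : Vec Bool k) → 0ᵥ +ᵥ u ≡ u
+ᵥ-identityˡ = zipWith-identityˡ xor-identityˡ

+ᵥ-identityʳ : ∀ {k} (u : Vec Bool k) → u +ᵥ 0ᵥ ≡ u
+ᵥ-identityʳ = zipWith-identityʳ xor-identityʳ

+ᵥ-comm : ∀ {k} (u v : Vec Bool k) → u +ᵥ v ≡ v +ᵥ u
+ᵥ-comm []       []       = refl
+ᵥ-comm (x ∷ u) (y ∷ v) = cong₂ _∷_ (xor-comm x y) (+ᵥ-comm u v)

+ᵥ-same : ∀ {k} (u : Vec Bool k) → u +ᵥ u ≡ 0ᵥ
+ᵥ-same []      = refl
+ᵥ-same (x ∷ u) = cong₂ _∷_ (xor-same x) (+ᵥ-same u)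

+ᵥ-interchange : ∀ {k} (u v w z : Vec Bool k) → (u +ᵥ v) +ᵥ (w +ᵥ z) ≡ (u +ᵥ w) +ᵥ (v +ᵥ z)
+ᵥ-interchange u v w z = begin
  (u +ᵥ v) +ᵥ (w +ᵥ z)   ≡⟨ +ᵥ-assoc u v (w +ᵥ z) ⟩
  u +ᵥ (v +ᵥ (w +ᵥ z))   ≡⟨ cong (u +ᵥ_) (sym (+ᵥ-assoc v w z)) ⟩
  u +ᵥ ((v +ᵥ w) +ᵥ z)   ≡⟨ cong (λ t → u +ᵥ (t +ᵥ z)) (+ᵥ-comm v w) ⟩
  u +ᵥ ((w +ᵥ v) +ᵥ z)   ≡⟨ cong (u +ᵥ_) (+ᵥ-assoc w v z) ⟩
  u +ᵥ (w +ᵥ (v +ᵥ z))   ≡⟨ sym (+ᵥ-assoc u w (v +ᵥ z)) ⟩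
  (u +ᵥ w) +ᵥ (v +ᵥ z)   ∎
  where open ≡-Reasoning

·-distrib-xor : ∀ {k} x y (u : Vec Bool k) → (x xor y) · u ≡ x · u +ᵥ y · u
·-distrib-xor false false u = sym (+ᵥ-same 0ᵥ)
·-distrib-xor false true  u = sym (+ᵥ-identityˡ u)
·-distrib-xor true  false u = sym (+ᵥ-identityʳ u)
·-distrib-xor true  true  u = sym (+ᵥ-same u)

·-distrib-+ᵥ : ∀ {k} x (u v : Vec Bool k) → x · (u +ᵥ v) ≡ x · u +ᵥ x · v
·-distrib-+ᵥ false u v = sym (+ᵥ-same 0ᵥ)
·-distrib-+ᵥ true  u v = refl

Additive : ∀ {k k′} → (Vec Bool k → Vec Bool k′) → Set
Additive h = ∀ u v → h (u +ᵥ v) ≡ h u +ᵥ h v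

additive⇒0ᵥ : ∀ {k k′} {h : Vec Bool k → Vec Bool k′} → Additive h → h 0ᵥ ≡ 0ᵥ
additive⇒0ᵥ {h = h} h-additive = begin
  h 0ᵥ            ≡⟨ cong h (sym (+ᵥ-same 0ᵥ)) ⟩
  h (0ᵥ +ᵥ 0ᵥ)    ≡⟨ h-additive 0ᵥ 0ᵥ ⟩
  h 0ᵥ +ᵥ h 0ᵥ    ≡⟨ +ᵥ-same (h 0ᵥ) ⟩
  0ᵥ              ∎
  where open ≡-Reasoning

additive-· : ∀ {k k′} {h : Vec Bool k → Vec Bool k′} → Additive h → ∀ x u → h (x · u) ≡ x · h u
additive-· h-additive false u = additive⇒0ᵥ h-additive
additive-· h-additive true  u = refl

sumCols-∷ : ∀ {m k} (A : BinRep (suc m) k) x (S : Subset m) →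
            sumCols A (x ∷ S) ≡ x · A zero +ᵥ sumCols (A ∘ suc) S
sumCols-∷ {m} A x S = begin
  sumCols A (x ∷ S)                ≡⟨ cong (λ r → if x then A zero +ᵥ r else r) tail-sum ⟩
  (if x then A zero +ᵥ R else R)   ≡⟨ if-+ᵥ x ⟩
  x · A zero +ᵥ R                  ∎
  where
  open ≡-Reasoning
  R = sumCols (A ∘ suc) S
  step = λ e acc → if lookup (x ∷ S) e then A e +ᵥ acc else acc
  tail-sum : Data.List.foldr step 0ᵥ (Data.List.tabulate suc) ≡ R
  tail-sum = trans (cong (Data.List.foldr step 0ᵥ) (sym (map-tabulate id suc)))
                   (foldr-map step suc 0ᵥ (allFin m))
  if-+ᵥ : ∀ x → (if x then A zero +ᵥ R else R) ≡ x · A zero +ᵥ R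
  if-+ᵥ false = sym (+ᵥ-identityˡ R)
  if-+ᵥ true  = refl

sumCols-∅ : ∀ {m k} (A : BinRep m k) → sumCols A ∅ ≡ 0ᵥ
sumCols-∅ {zero}  A = refl
sumCols-∅ {suc m} A = trans (sumCols-∷ A false ∅) (trans (+ᵥ-identityˡ _) (sumCols-∅ (A ∘ suc)))

sumCols-⁅⁆ : ∀ {m k} (A : BinRep m k) (e : Fin m) → sumCols A ⁅ e ⁆ ≡ A e
sumCols-⁅⁆ A zero    =
  trans (sumCols-∷ A true ∅) (trans (cong (A zero +ᵥ_) (sumCols-∅ (A ∘ suc))) (+ᵥ-identityʳ (A zero)))
sumCols-⁅⁆ A (suc e) =
  trans (sumCols-∷ A false ⁅ e ⁆) (trans (+ᵥ-identityˡ _) (sumCols-⁅⁆ (A ∘ suc) e))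

sumCols-cong : ∀ {m k} {A A′ : BinRep m k} (S : Subset m) → (∀ {e} → e ∈ S → A e ≡ A′ e) →
               sumCols A S ≡ sumCols A′ S
sumCols-cong [] _ = refl
sumCols-cong {A = A} {A′} (x ∷ S) A≗A′ = begin
  sumCols A (x ∷ S)                      ≡⟨ sumCols-∷ A x S ⟩
  x · A zero +ᵥ sumCols (A ∘ suc) S      ≡⟨ cong₂ _+ᵥ_ (head-cong x A≗A′) (sumCols-cong S (A≗A′ ∘ there)) ⟩
  x · A′ zero +ᵥ sumCols (A′ ∘ suc) S    ≡⟨ sumCols-∷ A′ x S ⟨
  sumCols A′ (x ∷ S)                     ∎
  where
  open ≡-Reasoning
  head-cong : ∀ {S} x → (∀ {e} → e ∈ x ∷ S → A e ≡ A′ e) → x · A zero ≡ x · A′ zero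
  head-cong false _    = refl
  head-cong true  A≗A′ = A≗A′ here

sumCols-additive : ∀ {m k} (A : BinRep m k) → Additive (sumCols A)
sumCols-additive A [] [] = sym (+ᵥ-same 0ᵥ)
sumCols-additive A (x ∷ S) (y ∷ T) = begin
  sumCols A ((x xor y) ∷ (S +ᵥ T))                    ≡⟨ sumCols-∷ A (x xor y) (S +ᵥ T) ⟩
  (x xor y) · a +ᵥ R (S +ᵥ T)
    ≡⟨ cong₂ _+ᵥ_ (·-distrib-xor x y a) (sumCols-additive (A ∘ suc) S T) ⟩
  (x · a +ᵥ y · a) +ᵥ (R S +ᵥ R T)                    ≡⟨ +ᵥ-interchange (x · a) (y · a) (R S) (R T) ⟩
  (x · a +ᵥ R S) +ᵥ (y · a +ᵥ R T)                    ≡⟨ cong₂ _+ᵥ_ (sumCols-∷ A x S) (sumCols-∷ A y T) ⟨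
  sumCols A (x ∷ S) +ᵥ sumCols A (y ∷ T)              ∎
  where
  open ≡-Reasoning
  a = A zero
  R = sumCols (A ∘ suc)

sumCols-distrib-+ᵥ : ∀ {m k} (A A′ : BinRep m k) (S : Subset m) →
                     sumCols (λ e → A e +ᵥ A′ e) S ≡ sumCols A S +ᵥ sumCols A′ S
sumCols-distrib-+ᵥ A A′ [] = sym (+ᵥ-same 0ᵥ)
sumCols-distrib-+ᵥ A A′ (x ∷ S) = begin
  sumCols (λ e → A e +ᵥ A′ e) (x ∷ S)                   ≡⟨ sumCols-∷ _ x S ⟩
  x · (a +ᵥ a′) +ᵥ sumCols (λ e → A (suc e) +ᵥ A′ (suc e)) S
      ≡⟨ cong₂ _+ᵥ_ (·-distrib-+ᵥ x a a′) (sumCols-distrib-+ᵥ (A ∘ suc) (A′ ∘ suc) S) ⟩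
  (x · a +ᵥ x · a′) +ᵥ (R S +ᵥ R′ S)                   ≡⟨ +ᵥ-interchange (x · a) (x · a′) (R S) (R′ S) ⟩
  (x · a +ᵥ R S) +ᵥ (x · a′ +ᵥ R′ S)                   ≡⟨ cong₂ _+ᵥ_ (sumCols-∷ A x S) (sumCols-∷ A′ x S) ⟨
  sumCols A (x ∷ S) +ᵥ sumCols A′ (x ∷ S)              ∎
  where
  open ≡-Reasoning
  a = A zero
  a′ = A′ zero
  R = sumCols (A ∘ suc)
  R′ = sumCols (A′ ∘ suc)

sumCols-hom : ∀ {m k k′} {h : Vec Bool k → Vec Bool k′} → Additive h →
              (A : BinRep m k) (S : Subset m) → h (sumCols A S) ≡ sumCols (h ∘ A) S
sumCols-hom h-additive A [] = additive⇒0ᵥ h-additive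
sumCols-hom {h = h} h-additive A (x ∷ S) = begin
  h (sumCols A (x ∷ S))                        ≡⟨ cong h (sumCols-∷ A x S) ⟩
  h (x · A zero +ᵥ sumCols (A ∘ suc) S)        ≡⟨ h-additive _ _ ⟩
  h (x · A zero) +ᵥ h (sumCols (A ∘ suc) S)
    ≡⟨ cong₂ _+ᵥ_ (additive-· h-additive x (A zero)) (sumCols-hom h-additive (A ∘ suc) S) ⟩
  x · h (A zero) +ᵥ sumCols (h ∘ A ∘ suc) S    ≡⟨ sumCols-∷ (h ∘ A) x S ⟨
  sumCols (h ∘ A) (x ∷ S)                      ∎
  where open ≡-Reasoning

sumCols-singletons : ∀ {n} (L : Subset n) → sumCols ⁅_⁆ L ≡ L
sumCols-singletons [] = refl
sumCols-singletons (x ∷ L) = begin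
  sumCols ⁅_⁆ (x ∷ L)                              ≡⟨ sumCols-∷ ⁅_⁆ x L ⟩
  x · ⁅ zero ⁆ +ᵥ sumCols ((false ∷_) ∘ ⁅_⁆) L
    ≡⟨ cong (x · ⁅ zero ⁆ +ᵥ_) (sumCols-hom {h = false ∷_} (λ _ _ → refl) ⁅_⁆ L) ⟨
  x · ⁅ zero ⁆ +ᵥ (false ∷ sumCols ⁅_⁆ L)
    ≡⟨ cong (λ t → x · ⁅ zero ⁆ +ᵥ (false ∷ t)) (sumCols-singletons L) ⟩
  x · ⁅ zero ⁆ +ᵥ (false ∷ L)                      ≡⟨ head-cell x ⟩
  x ∷ L                                            ∎
  where
  open ≡-Reasoning
  head-cell : ∀ x → x · ⁅ zero ⁆ +ᵥ (false ∷ L) ≡ x ∷ L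
  head-cell false = cong (false ∷_) (+ᵥ-identityˡ L)
  head-cell true  = cong (true ∷_) (+ᵥ-identityˡ L)

additive⇒sumCols : ∀ {n k} {φ : Subset n → Vec Bool k} → Additive φ →
                   ∀ L → φ L ≡ sumCols (λ i → φ ⁅ i ⁆) L
additive⇒sumCols {φ = φ} φ-additive L =
  trans (cong φ (sym (sumCols-singletons L))) (sumCols-hom φ-additive ⁅_⁆ L)

parity : ∀ {p} → Subset p → (Fin p → Bool) → Bool
parity L β = head (sumCols (λ l → β l ∷ []) L)

lookup-sumCols : ∀ {p k} (F : BinRep p k) L x →
                 lookup (sumCols F L) x ≡ parity L (λ l → lookup (F l) x)
lookup-sumCols F L x = cong head (sumCols-hom {h = λ v → lookup v x ∷ []} coordinate-additive F L)
  where
  coordinate-additive : Additive (λ v → lookup v x ∷ [])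
  coordinate-additive u v = cong (_∷ []) (lookup-zipWith _xor_ x u v)

parity-cong : ∀ {p} {β γ : Fin p → Bool} L → (∀ {l} → l ∈ L → β l ≡ γ l) →
              parity L β ≡ parity L γ
parity-cong L β≗γ = cong head (sumCols-cong L (cong (_∷ []) ∘ β≗γ))

parity-xor : ∀ {p} (β γ : Fin p → Bool) L →
             parity L (λ l → β l xor γ l) ≡ parity L β xor parity L γ
parity-xor β γ L = trans (cong head (sumCols-distrib-+ᵥ β′ γ′ L)) (head-+ᵥ (sumCols β′ L) (sumCols γ′ L))
  where
  β′ = λ l → β l ∷ []
  γ′ = λ l → γ l ∷ []
  head-+ᵥ : (u v : Vec Bool 1) → head (u +ᵥ v) ≡ head u xor head v
  head-+ᵥ (x ∷ []) (y ∷ []) = refl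

parity-⁅⁆ : ∀ {p} (L : Subset p) y → parity L (λ l → lookup ⁅ l ⁆ y) ≡ lookup L y
parity-⁅⁆ L y = trans (sym (lookup-sumCols ⁅_⁆ L y)) (cong (λ v → lookup v y) (sumCols-singletons L))

lookup-ext : ∀ {n} {A : Set} {u v : Vec A n} → (∀ i → lookup u i ≡ lookup v i) → u ≡ v
lookup-ext {u = u} {v} u≗v =
  trans (sym (tabulate∘lookup u)) (trans (tabulate-cong u≗v) (tabulate∘lookup v))

∉⇒lookup≡false : ∀ {n} {x : Fin n} {p : Subset n} → x ∉ p → lookup p x ≡ false
∉⇒lookup≡false {x = x} {p} x∉p with lookup p x in eq
... | false = refl
... | true  = ⊥-elim (x∉p (lookup⇒[]= x p eq))

lookup-cong-∈ : ∀ {n n′} {x : Fin n} {y : Fin n′} {p q} → (x ∈ p → y ∈ q) → (y ∈ q → x ∈ p) →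
                lookup p x ≡ lookup q y
lookup-cong-∈ {x = x} {p = p} to from with x ∈? p
... | yes x∈p = trans ([]=⇒lookup x∈p) (sym ([]=⇒lookup (to x∈p)))
... | no  x∉p = trans (∉⇒lookup≡false x∉p) (sym (∉⇒lookup≡false (x∉p ∘ from)))

∈-tabulate⁻ : ∀ {n} {β : Fin n → Bool} {x} → x ∈ tabulate β → β x ≡ true
∈-tabulate⁻ {β = β} {x} x∈ = trans (sym (lookup∘tabulate β x)) ([]=⇒lookup x∈)

∈-tabulate⁺ : ∀ {n} {β : Fin n → Bool} {x} → β x ≡ true → x ∈ tabulate β
∈-tabulate⁺ {β = β} {x} βx = lookup⇒[]= x _ (trans (lookup∘tabulate β x) βx)

x∈p+ᵥq⁺ : ∀ {n} {x : Fin n} {p q} → (x ∈ p × x ∉ q) ⊎ (x ∉ p × x ∈ q) → x ∈ p +ᵥ q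
x∈p+ᵥq⁺ {x = x} {p} {q} x∈ =
  lookup⇒[]= x (p +ᵥ q) (trans (lookup-zipWith _xor_ x p q) (bits x∈))
  where
  bits : (x ∈ p × x ∉ q) ⊎ (x ∉ p × x ∈ q) → lookup p x xor lookup q x ≡ true
  bits (inj₁ (x∈p , x∉q)) = cong₂ _xor_ ([]=⇒lookup x∈p) (∉⇒lookup≡false x∉q)
  bits (inj₂ (x∉p , x∈q)) = cong₂ _xor_ (∉⇒lookup≡false x∉p) ([]=⇒lookup x∈q)

x∈p+ᵥq⁻ : ∀ {n} {x : Fin n} p q → x ∈ p +ᵥ q → (x ∈ p × x ∉ q) ⊎ (x ∉ p × x ∈ q)
x∈p+ᵥq⁻ (true  ∷ p) (false ∷ q) here = inj₁ (here , λ ())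
x∈p+ᵥq⁻ (false ∷ p) (true  ∷ q) here = inj₂ ((λ ()) , here)
x∈p+ᵥq⁻ (s ∷ p) (t ∷ q) (there x∈) with x∈p+ᵥq⁻ p q x∈
... | inj₁ (x∈p , x∉q) = inj₁ (there x∈p , x∉q ∘ drop-there)
... | inj₂ (x∉p , x∈q) = inj₂ (x∉p ∘ drop-there , there x∈q)

∪≡+ᵥ : ∀ {n} (p q : Subset n) → Empty (p ∩ q) → p ∪ q ≡ p +ᵥ q
∪≡+ᵥ []          []          _     = refl
∪≡+ᵥ (true  ∷ p) (true  ∷ q) empty = ⊥-elim (empty (zero , here))
∪≡+ᵥ (true  ∷ p) (false ∷ q) empty = cong (true ∷_)  (∪≡+ᵥ p q (drop-∷-Empty empty))
∪≡+ᵥ (false ∷ p) (true  ∷ q) empty = cong (true ∷_)  (∪≡+ᵥ p q (drop-∷-Empty empty))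
∪≡+ᵥ (false ∷ p) (false ∷ q) empty = cong (false ∷_) (∪≡+ᵥ p q (drop-∷-Empty empty))

x∉p-x : ∀ {n} (p : Subset n) (x : Fin n) → x ∉ p - x
x∉p-x (s ∷ p) zero    ()
x∉p-x (s ∷ p) (suc x) (there x∈) = x∉p-x p x x∈

x∈p-y⇒x≢y : ∀ {n} {x y : Fin n} {p} → x ∈ p - y → x ≢ y
x∈p-y⇒x≢y {x = x} {p = p} x∈ refl = x∉p-x p x x∈

Empty[p-x]⇒≡x : ∀ {n} {x y : Fin n} {p} → Empty (p - x) → y ∈ p → y ≡ x
Empty[p-x]⇒≡x {x = x} {y} empty y∈p with y ≟ x
... | yes y≡x = y≡x
... | no  y≢x = ⊥-elim (empty (y , x∈p∧x≢y⇒x∈p-y y∈p y≢x))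

x∈p∪⁅y⁆∧x≢y⇒x∈p : ∀ {n} {x y : Fin n} {p} → x ∈ p ∪ ⁅ y ⁆ → x ≢ y → x ∈ p
x∈p∪⁅y⁆∧x≢y⇒x∈p {y = y} {p} x∈ x≢y with x∈p∪q⁻ p ⁅ y ⁆ x∈
... | inj₁ x∈p = x∈p
... | inj₂ x∈y = ⊥-elim (x≢y (x∈⁅y⁆⇒x≡y y x∈y))

∈-pair⁻ : ∀ {n} {x e f : Fin n} → x ∈ ⁅ e ⁆ ∪ ⁅ f ⁆ → x ≡ e ⊎ x ≡ f
∈-pair⁻ {e = e} {f} x∈ with x∈p∪q⁻ ⁅ e ⁆ ⁅ f ⁆ x∈
... | inj₁ x∈e = inj₁ (x∈⁅y⁆⇒x≡y e x∈e)
... | inj₂ x∈f = inj₂ (x∈⁅y⁆⇒x≡y f x∈f)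

⊂-pair⇒subsingleton : ∀ {n} {e f x y : Fin n} {T} → T ⊂ ⁅ e ⁆ ∪ ⁅ f ⁆ → x ∈ T → y ∈ T → x ≡ y
⊂-pair⇒subsingleton (T⊆ , z , z∈ , z∉T) x∈T y∈T
  with ∈-pair⁻ (T⊆ x∈T) | ∈-pair⁻ (T⊆ y∈T) | ∈-pair⁻ z∈
... | inj₁ refl | inj₁ refl | _         = refl
... | inj₂ refl | inj₂ refl | _         = refl
... | inj₁ refl | inj₂ refl | inj₁ refl = ⊥-elim (z∉T x∈T)
... | inj₁ refl | inj₂ refl | inj₂ refl = ⊥-elim (z∉T y∈T)
... | inj₂ refl | inj₁ refl | inj₁ refl = ⊥-elim (z∉T y∈T)
... | inj₂ refl | inj₁ refl | inj₂ refl = ⊥-elim (z∉T x∈T)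

_⊂?_ : ∀ {n} → Decidable (_⊂_ {n})
T ⊂? S = T ⊆? S ×-dec any? (λ x → x ∈? S ×-dec ¬? (x ∈? T))

injective⇒≤∣∣ : ∀ {p m} (h : Fin p → Fin m) → (∀ {i j} → h i ≡ h j → i ≡ j) →
                ∀ {Y} → (∀ i → h i ∈ Y) → p ≤ ∣ Y ∣
injective⇒≤∣∣ {zero}  h h-injective h∈Y = z≤n
injective⇒≤∣∣ {suc p} h h-injective h∈Y =
  ≤-trans (s≤s (injective⇒≤∣∣ (h ∘ suc) (suc-injective ∘ h-injective) h[suc]∈Y-h[0]))
          (x∈p⇒∣p-x∣<∣p∣ (h∈Y zero))
  where
  h[suc]∈Y-h[0] : ∀ i → h (suc i) ∈ _ - h zero
  h[suc]∈Y-h[0] i = x∈p∧x≢y⇒x∈p-y (h∈Y (suc i)) (λ eq → 0≢1+n (sym (h-injective eq)))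

module _ {m k : ℕ} (A : BinRep m k) where

  dependent? : ∀ S → Dec (Dependent A S)
  dependent? S = anySubset? λ T → T ⊆? S ×-dec nonempty? T ×-dec ≡-dec _≟ᵇ_ (sumCols A T) 0ᵥ

  dependent⇒⊇circuit : ∀ {S} → Dependent A S → ∃ λ C → C ⊆ S × Circuit A C
  dependent⇒⊇circuit {S} = go (⊂-wellFounded S)
    where
    go : ∀ {S} → Acc _⊂_ S → Dependent A S → ∃ λ C → C ⊆ S × Circuit A C
    go {S} (acc smaller) S-dependent with anySubset? (λ T → T ⊂? S ×-dec dependent? T)
    ... | no  none = S , ⊆-refl , S-dependent , λ T T⊂S T-dependent → none (T , T⊂S , T-dependent)
    ... | yes (T , T⊂S , T-dependent) with go (smaller T⊂S) T-dependent
    ...   | C , C⊆T , C-circuit = C , ⊆-trans C⊆T (proj₁ T⊂S) , C-circuit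

  >rank⇒dependent : ∀ {r S} → HasRank A r → r < ∣ S ∣ → Dependent A S
  >rank⇒dependent {S = S} (_ , bound) r<∣S∣ with dependent? S
  ... | yes S-dependent = S-dependent
  ... | no  S-independent = ⊥-elim (<⇒≱ r<∣S∣ (bound S S-independent))

  basis-spans : ∀ {B} → Basis A B → ∀ e → ∃ λ T → T ⊆ B × A e ≡ sumCols A T
  basis-spans {B} (B-independent , B-maximal) e with e ∈? B
  ... | yes e∈B = ⁅ e ⁆ , (λ x∈ → subst (_∈ B) (sym (x∈⁅y⁆⇒x≡y e x∈)) e∈B) , sym (sumCols-⁅⁆ A e)
  ... | no  e∉B with B-maximal e e∉B
  ...   | U , U⊆ , U-nonempty , U-sum with e ∈? U
  ...     | no  e∉U = ⊥-elim (B-independent (U , U⊆B , U-nonempty , U-sum))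
    where
    U⊆B : U ⊆ B
    U⊆B x∈U = x∈p∪⁅y⁆∧x≢y⇒x∈p (U⊆ x∈U) λ { refl → e∉U x∈U }
  ...     | yes e∈U = U +ᵥ ⁅ e ⁆ , U+e⊆B , sym sum≡
    where
    U+e⊆B : U +ᵥ ⁅ e ⁆ ⊆ B
    U+e⊆B x∈ with x∈p+ᵥq⁻ U ⁅ e ⁆ x∈
    ... | inj₁ (x∈U , x∉e) = x∈p∪⁅y⁆∧x≢y⇒x∈p (U⊆ x∈U) λ { refl → x∉e (x∈⁅x⁆ e) }
    ... | inj₂ (x∉U , x∈e) = ⊥-elim (x∉U (subst (_∈ U) (sym (x∈⁅y⁆⇒x≡y e x∈e)) e∈U))
    sum≡ : sumCols A (U +ᵥ ⁅ e ⁆) ≡ A e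
    sum≡ = begin
      sumCols A (U +ᵥ ⁅ e ⁆)              ≡⟨ sumCols-additive A U ⁅ e ⁆ ⟩
      sumCols A U +ᵥ sumCols A ⁅ e ⁆      ≡⟨ cong₂ _+ᵥ_ U-sum (sumCols-⁅⁆ A e) ⟩
      0ᵥ +ᵥ A e                           ≡⟨ +ᵥ-identityˡ (A e) ⟩
      A e                                 ∎
      where open ≡-Reasoning

module Colouring {m n : ℕ} (c : Fin m → Fin n) where

  Rainbow : Subset m → Set
  Rainbow S = ∀ e f → e ∈ S → f ∈ S → c e ≡ c f → e ≡ f

  subsingleton⇒rainbow : ∀ {S} → (∀ {e f} → e ∈ S → f ∈ S → e ≡ f) → Rainbow S
  subsingleton⇒rainbow subsingleton _ _ e∈S f∈S _ = subsingleton e∈S f∈S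

  rainbow-⊆ : ∀ {S T} → T ⊆ S → Rainbow S → Rainbow T
  rainbow-⊆ T⊆S S-rainbow e f e∈T f∈T = S-rainbow e f (T⊆S e∈T) (T⊆S f∈T)

  singleton-rainbow : ∀ e → Rainbow ⁅ e ⁆
  singleton-rainbow e =
    subsingleton⇒rainbow λ x∈ y∈ → trans (x∈⁅y⁆⇒x≡y e x∈) (sym (x∈⁅y⁆⇒x≡y e y∈))

  pair-rainbow : ∀ {e f} → (c e ≡ c f → e ≡ f) → Rainbow (⁅ e ⁆ ∪ ⁅ f ⁆)
  pair-rainbow e≈f x y x∈ y∈ cx≡cy with ∈-pair⁻ x∈ | ∈-pair⁻ y∈
  ... | inj₁ refl | inj₁ refl = refl
  ... | inj₂ refl | inj₂ refl = refl
  ... | inj₁ refl | inj₂ refl = e≈f cx≡cy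
  ... | inj₂ refl | inj₁ refl = sym (e≈f (sym cx≡cy))

  ∈-colourClass⁻ : ∀ {e i} → e ∈ ColourClass c i → c e ≡ i
  ∈-colourClass⁻ e∈ = toWitness (Equivalence.from T-≡ (∈-tabulate⁻ e∈))

  ∈-colourClass⁺ : ∀ {e i} → c e ≡ i → e ∈ ColourClass c i
  ∈-colourClass⁺ ce≡i = ∈-tabulate⁺ (Equivalence.to T-≡ (fromWitness ce≡i))

  Transversal : (Fin n → Fin m) → Set
  Transversal g = ∀ i → c (g i) ≡ i

  -- For a transversal g this is { g l ∣ l ∈ L }; testing membership through c makes it additive in L.
  image : (Fin n → Fin m) → Subset n → Subset m
  image g L = tabulate λ e → ⌊ g (c e) ≟ e ⌋ ∧ lookup L (c e)

  preimage : (Fin n → Fin m) → Subset m → Subset n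
  preimage g T = tabulate λ i → lookup T (g i)

  ∈-image⁻ : ∀ g L {e} → e ∈ image g L → g (c e) ≡ e × c e ∈ L
  ∈-image⁻ g L {e} e∈ with g (c e) ≟ e | ∈-tabulate⁻ e∈
  ... | yes g[ce]≡e | L[ce]≡true = g[ce]≡e , lookup⇒[]= (c e) L L[ce]≡true

  ∈-image⁺ : ∀ {g L l} → Transversal g → l ∈ L → g l ∈ image g L
  ∈-image⁺ {g} {L} {l} g-transversal l∈L = ∈-tabulate⁺ (cong₂ _∧_ g[c[gl]]≡gl L[c[gl]]≡true)
    where
    g[c[gl]]≡gl : ⌊ g (c (g l)) ≟ g l ⌋ ≡ true
    g[c[gl]]≡gl = Equivalence.to T-≡ (fromWitness (cong g (g-transversal l)))
    L[c[gl]]≡true : lookup L (c (g l)) ≡ true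
    L[c[gl]]≡true = []=⇒lookup (subst (_∈ L) (sym (g-transversal l)) l∈L)

  image-rainbow : ∀ g L → Rainbow (image g L)
  image-rainbow g L e f e∈ f∈ ce≡cf =
    trans (sym (proj₁ (∈-image⁻ g L e∈))) (trans (cong g ce≡cf) (proj₁ (∈-image⁻ g L f∈)))

  image-additive : ∀ g → Additive (image g)
  image-additive g L L′ = lookup-ext λ e → begin
    lookup (image g (L +ᵥ L′)) e                         ≡⟨ lookup∘tabulate _ e ⟩
    a e ∧ lookup (L +ᵥ L′) (c e)                         ≡⟨ cong (a e ∧_) (lookup-zipWith _xor_ (c e) L L′) ⟩
    a e ∧ (lookup L (c e) xor lookup L′ (c e))           ≡⟨ ∧-distribˡ-xor (a e) _ _ ⟩
    (a e ∧ lookup L (c e)) xor (a e ∧ lookup L′ (c e))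
      ≡⟨ cong₂ _xor_ (lookup∘tabulate _ e) (lookup∘tabulate _ e) ⟨
    lookup (image g L) e xor lookup (image g L′) e       ≡⟨ lookup-zipWith _xor_ e (image g L) (image g L′) ⟨
    lookup (image g L +ᵥ image g L′) e                   ∎
    where
    open ≡-Reasoning
    a = λ e → ⌊ g (c e) ≟ e ⌋

  image-⁅⁆ : ∀ {g} → Transversal g → ∀ l → image g ⁅ l ⁆ ≡ ⁅ g l ⁆
  image-⁅⁆ {g} g-transversal l =
    ⊆-antisym ⊆⁅gl⁆ (λ e∈ → subst (_∈ image g ⁅ l ⁆) (sym (x∈⁅y⁆⇒x≡y (g l) e∈)) gl∈)
    where
    gl∈ : g l ∈ image g ⁅ l ⁆
    gl∈ = ∈-image⁺ g-transversal (x∈⁅x⁆ l)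
    ⊆⁅gl⁆ : image g ⁅ l ⁆ ⊆ ⁅ g l ⁆
    ⊆⁅gl⁆ {e} e∈ with ∈-image⁻ g ⁅ l ⁆ e∈
    ... | g[ce]≡e , ce∈ =
      subst (_∈ ⁅ g l ⁆) (trans (cong g (sym (x∈⁅y⁆⇒x≡y l ce∈))) g[ce]≡e) (x∈⁅x⁆ (g l))

  sumCols-image : ∀ {k} (A : BinRep m k) {g} → Transversal g → ∀ L →
                  sumCols A (image g L) ≡ sumCols (A ∘ g) L
  sumCols-image A {g} g-transversal L = begin
    sumCols A (image g L)                          ≡⟨ additive⇒sumCols additive L ⟩
    sumCols (λ l → sumCols A (image g ⁅ l ⁆)) L    ≡⟨ sumCols-cong L (λ {l} _ → column l) ⟩
    sumCols (A ∘ g) L                              ∎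
    where
    open ≡-Reasoning
    additive : Additive (sumCols A ∘ image g)
    additive L L′ =
      trans (cong (sumCols A) (image-additive g L L′)) (sumCols-additive A (image g L) (image g L′))
    column : ∀ l → sumCols A (image g ⁅ l ⁆) ≡ A (g l)
    column l = trans (cong (sumCols A) (image-⁅⁆ g-transversal l)) (sumCols-⁅⁆ A (g l))

  image-preimage : ∀ {g T} → Transversal g → T ⊆ image g ⊤ → image g (preimage g T) ≡ T
  image-preimage {g} {T} g-transversal T⊆ = ⊆-antisym ⊆T T⊆image
    where
    ⊆T : image g (preimage g T) ⊆ T
    ⊆T e∈ with ∈-image⁻ g (preimage g T) e∈
    ... | g[ce]≡e , ce∈ = subst (_∈ T) g[ce]≡e (lookup⇒[]= _ T (∈-tabulate⁻ ce∈))
    T⊆image : T ⊆ image g (preimage g T)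
    T⊆image {e} e∈T = subst (_∈ image g (preimage g T)) g[ce]≡e (∈-image⁺ g-transversal ce∈)
      where
      g[ce]≡e = proj₁ (∈-image⁻ g ⊤ (T⊆ e∈T))
      ce∈ : c e ∈ preimage g T
      ce∈ = ∈-tabulate⁺ ([]=⇒lookup (subst (_∈ T) (sym g[ce]≡e) e∈T))

  patch : Subset n → (Fin n → Fin m) → (Fin n → Fin m) → Fin n → Fin m
  patch L h g l with l ∈? L
  ... | yes _ = h l
  ... | no  _ = g l

  patch-∈ : ∀ {L h g l} → l ∈ L → patch L h g l ≡ h l
  patch-∈ {L} {l = l} l∈L with l ∈? L
  ... | yes _   = refl
  ... | no  l∉L = ⊥-elim (l∉L l∈L)

  patch-∉ : ∀ {L h g l} → l ∉ L → patch L h g l ≡ g l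
  patch-∉ {L} {l = l} l∉L with l ∈? L
  ... | yes l∈L = ⊥-elim (l∉L l∈L)
  ... | no  _   = refl

  patch-transversal : ∀ {L h g} → (∀ {l} → l ∈ L → c (h l) ≡ l) → Transversal g →
                      Transversal (patch L h g)
  patch-transversal {L} h-transversal g-transversal l with l ∈? L
  ... | yes l∈L = h-transversal l∈L
  ... | no  _   = g-transversal l

module Digraph {n : ℕ} (R : Fin n → Fin n → Set) where

  SourceIn : Subset n → Fin n → Set
  SourceIn K j = j ∈ K × (∀ i → i ∈ K → R i j → i ≡ j)

  SinkIn : Subset n → Fin n → Set
  SinkIn K s = s ∈ K × (∀ j → j ∈ K → R s j → j ≡ s)

  PrivateSuccessor : Subset n → Fin n → Fin n → Set
  PrivateSuccessor K i j = R i j × SourceIn (K - i) j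

  source-extend : ∀ {K i j} → ¬ R i j → SourceIn (K - i) j → SourceIn K j
  source-extend {K} {i} {j} ¬Rij (j∈K-i , j-source) = p─q⊆p K ⁅ i ⁆ j∈K-i , only-j
    where
    only-j : ∀ l → l ∈ K → R l j → l ≡ j
    only-j l l∈K Rlj with l ≟ i
    ... | yes refl = ⊥-elim (¬Rij Rlj)
    ... | no  l≢i  = j-source l (x∈p∧x≢y⇒x∈p-y l∈K l≢i) Rlj

  sink-extend : ∀ {K j s} → SourceIn K j → SinkIn (K - j) s → SinkIn K s
  sink-extend {K} {j} {s} (_ , j-source) (s∈K-j , s-sink) = s∈K , only-s
    where
    s∈K = p─q⊆p K ⁅ j ⁆ s∈K-j
    only-s : ∀ l → l ∈ K → R s l → l ≡ s
    only-s l l∈K Rsl with l ≟ j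
    ... | yes refl = ⊥-elim (x∈p-y⇒x≢y s∈K-j (j-source s s∈K Rsl))
    ... | no  l≢j  = s-sink l (x∈p∧x≢y⇒x∈p-y l∈K l≢j) Rsl

  -- Without a source in K, every i ∈ K has an edge to a source of K - i, which receives no
  -- other edge from K.
  source-exists : Decidable R → (∀ K → Nonempty K → ¬ (∀ i → i ∈ K → ∃ (PrivateSuccessor K i))) →
                  ∀ K → Nonempty K → ∃ (SourceIn K)
  source-exists R? no-private-successors K = go (⊂-wellFounded K)
    where
    source? : ∀ K j → Dec (SourceIn K j)
    source? K j = j ∈? K ×-dec all? λ i → i ∈? K →-dec R? i j →-dec i ≟ j
    go : ∀ {K} → Acc _⊂_ K → Nonempty K → ∃ (SourceIn K)
    go {K} (acc smaller) K-nonempty with any? (source? K)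
    ... | yes source = source
    ... | no  no-source = ⊥-elim (no-private-successors K K-nonempty private-successor)
      where
      private-successor : ∀ i → i ∈ K → ∃ (PrivateSuccessor K i)
      private-successor i i∈K with nonempty? (K - i)
      ... | no  K-i-empty = ⊥-elim (no-source (i , i∈K , λ l l∈K _ → Empty[p-x]⇒≡x K-i-empty l∈K))
      ... | yes K-i-nonempty with go (smaller (x∈p⇒p-x⊂p i∈K)) K-i-nonempty
      ...   | j , j-source with R? i j
      ...     | yes Rij = j , Rij , j-source
      ...     | no  ¬Rij = ⊥-elim (no-source (j , source-extend ¬Rij j-source))

  sink-exists : (∀ K → Nonempty K → ∃ (SourceIn K)) → ∀ K → Nonempty K → ∃ (SinkIn K)
  sink-exists sources K = go (⊂-wellFounded K)
    where
    go : ∀ {K} → Acc _⊂_ K → Nonempty K → ∃ (SinkIn K)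
    go {K} (acc smaller) K-nonempty with sources K K-nonempty
    ... | j , j-source@(j∈K , _) with nonempty? (K - j)
    ...   | no  K-j-empty = j , j∈K , λ l l∈K _ → Empty[p-x]⇒≡x K-j-empty l∈K
    ...   | yes K-j-nonempty with go (smaller (x∈p⇒p-x⊂p j∈K)) K-j-nonempty
    ...     | s , s-sink = s , sink-extend j-source s-sink

rainbow⇒independent : ∀ {m k n} (A : BinRep m k) (c : Fin m → Fin n) → CircuitAchromatic A c →
                      ∀ {S} → Colouring.Rainbow c S → Independent A S
rainbow⇒independent A c achromatic S-rainbow S-dependent with dependent⇒⊇circuit A S-dependent
... | C , C⊆S , C-circuit = achromatic C C-circuit (Colouring.rainbow-⊆ c C⊆S S-rainbow)

module Achromatic {m k n : ℕ} (A : BinRep m k) (c : Fin m → Fin n) (rank : HasRank A n)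
                  (surjective : Surjective c) (achromatic : CircuitAchromatic A c) where

  open Colouring c

  b : Fin n → Fin m
  b i = proj₁ (surjective i)

  b-transversal : Transversal b
  b-transversal i = proj₂ (surjective i)

  through : Fin m → Fin n → Fin m
  through e = patch ⁅ c e ⁆ (const e) b

  through-transversal : ∀ e → Transversal (through e)
  through-transversal e = patch-transversal (λ l∈ → sym (x∈⁅y⁆⇒x≡y _ l∈)) b-transversal

  through-colour : ∀ e → through e (c e) ≡ e
  through-colour e = patch-∈ {⁅ c e ⁆} {const e} {b} (x∈⁅x⁆ (c e))

  image-independent : ∀ g L → Independent A (image g L)
  image-independent g L = rainbow⇒independent A c achromatic (image-rainbow g L)

  transversal-columns-independent : ∀ {g L} → Transversal g → Nonempty L → sumCols (A ∘ g) L ≢ 0ᵥ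
  transversal-columns-independent {g} {L} g-transversal (l , l∈L) sum≡0 =
    image-independent g L (image g L , ⊆-refl , (g l , ∈-image⁺ g-transversal l∈L) , image-sum≡0)
    where
    image-sum≡0 : sumCols A (image g L) ≡ 0ᵥ
    image-sum≡0 = trans (sumCols-image A g-transversal L) sum≡0

  transversal-basis : ∀ {g} → Transversal g → Basis A (image g ⊤)
  transversal-basis {g} g-transversal = image-independent g ⊤ , maximal
    where
    maximal : ∀ e → e ∉ image g ⊤ → Dependent A (image g ⊤ ∪ ⁅ e ⁆)
    maximal e e∉ = >rank⇒dependent A rank (injective⇒≤∣∣ h h-injective h∈)
      where
      h : Fin (suc n) → Fin m
      h zero    = e
      h (suc i) = g i
      e≢g : ∀ i → e ≢ g i
      e≢g i refl = e∉ (∈-image⁺ g-transversal ∈⊤)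
      h-injective : ∀ {i j} → h i ≡ h j → i ≡ j
      h-injective {zero}  {zero}  _  = refl
      h-injective {zero}  {suc j} eq = ⊥-elim (e≢g j eq)
      h-injective {suc i} {zero}  eq = ⊥-elim (e≢g i (sym eq))
      h-injective {suc i} {suc j} eq =
        cong suc (trans (sym (g-transversal i)) (trans (cong c eq) (g-transversal j)))
      h∈ : ∀ i → h i ∈ image g ⊤ ∪ ⁅ e ⁆
      h∈ zero    = x∈p∪q⁺ (inj₂ (x∈⁅x⁆ e))
      h∈ (suc i) = x∈p∪q⁺ (inj₁ (∈-image⁺ g-transversal ∈⊤))

  lin : Subset n → Vec Bool k
  lin = sumCols (A ∘ b)

  coordinates : ∀ e → ∃ λ P → A e ≡ lin P
  coordinates e with basis-spans A (transversal-basis b-transversal) e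
  ... | T , T⊆ , Ae≡ = preimage b T , (begin
    A e                                  ≡⟨ Ae≡ ⟩
    sumCols A T                          ≡⟨ cong (sumCols A) (image-preimage b-transversal T⊆) ⟨
    sumCols A (image b (preimage b T))   ≡⟨ sumCols-image A b-transversal (preimage b T) ⟩
    lin (preimage b T)                   ∎)
    where open ≡-Reasoning

  coords : Fin m → Subset n
  coords e = proj₁ (coordinates e)

  column≡lin-coords : ∀ e → A e ≡ lin (coords e)
  column≡lin-coords e = proj₂ (coordinates e)

  sumCols≡lin-coords : ∀ {p} (h : Fin p → Fin m) T →
                       sumCols (A ∘ h) T ≡ lin (sumCols (coords ∘ h) T)
  sumCols≡lin-coords h T =
    trans (sumCols-cong T (λ {x} _ → column≡lin-coords (h x)))
          (sym (sumCols-hom (sumCols-additive (A ∘ b)) (coords ∘ h) T))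

  zero-sum⇒Empty[coords-sum] : ∀ {T} → sumCols A T ≡ 0ᵥ → Empty (sumCols coords T)
  zero-sum⇒Empty[coords-sum] {T} sum≡0 nonempty =
    transversal-columns-independent b-transversal nonempty (trans (sym (sumCols≡lin-coords id T)) sum≡0)

  -- Otherwise, taking g on L and b elsewhere, the columns over L + σ sum to lin σ + lin σ = 0.
  coords-sum-meets : ∀ {g L} → Transversal g → Nonempty L →
                     ¬ (∀ {i} → i ∈ L → i ∉ sumCols (coords ∘ g) L)
  coords-sum-meets {g} {L} g-transversal (i , i∈L) disjoint =
    transversal-columns-independent g′-transversal (i , x∈p+ᵥq⁺ (inj₁ (i∈L , disjoint i∈L))) sum≡0
    where
    σ = sumCols (coords ∘ g) L
    g′ = patch L g b
    g′-transversal : Transversal g′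
    g′-transversal = patch-transversal (λ {l} _ → g-transversal l) b-transversal
    sum≡0 : sumCols (A ∘ g′) (L +ᵥ σ) ≡ 0ᵥ
    sum≡0 = begin
      sumCols (A ∘ g′) (L +ᵥ σ)                  ≡⟨ sumCols-additive (A ∘ g′) L σ ⟩
      sumCols (A ∘ g′) L +ᵥ sumCols (A ∘ g′) σ   ≡⟨ cong₂ _+ᵥ_ (sumCols-cong L on-L) (sumCols-cong σ on-σ) ⟩
      sumCols (A ∘ g) L +ᵥ lin σ                 ≡⟨ cong (_+ᵥ lin σ) (sumCols≡lin-coords g L) ⟩
      lin σ +ᵥ lin σ                             ≡⟨ +ᵥ-same (lin σ) ⟩
      0ᵥ                                         ∎
      where
      open ≡-Reasoning
      on-L : ∀ {l} → l ∈ L → A (g′ l) ≡ A (g l)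
      on-L = cong A ∘ patch-∈ {L} {g} {b}
      on-σ : ∀ {l} → l ∈ σ → A (g′ l) ≡ A (b l)
      on-σ l∈σ = cong A (patch-∉ {L} {g} {b} (λ l∈L → disjoint l∈L l∈σ))

  colour∈coords : ∀ e → c e ∈ coords e
  colour∈coords e with c e ∈? coords e
  ... | yes ce∈ = ce∈
  ... | no  ce∉ = ⊥-elim (coords-sum-meets (through-transversal e) (c e , x∈⁅x⁆ (c e)) disjoint)
    where
    σ≡ : sumCols (coords ∘ through e) ⁅ c e ⁆ ≡ coords e
    σ≡ = trans (sumCols-⁅⁆ (coords ∘ through e) (c e)) (cong coords (through-colour e))
    disjoint : ∀ {i} → i ∈ ⁅ c e ⁆ → i ∉ sumCols (coords ∘ through e) ⁅ c e ⁆
    disjoint i∈ i∈σ = ce∉ (subst₂ _∈_ (x∈⁅y⁆⇒x≡y _ i∈) σ≡ i∈σ)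

  Feeds : Fin n → Fin n → Set
  Feeds i j = ∃ λ e → c e ≡ j × i ∈ coords e

  feeds? : Decidable Feeds
  feeds? i j = any? λ e → c e ≟ j ×-dec i ∈? coords e

  open Digraph Feeds

  -- Represent each colour l = f i of L = f(K) by the witness w i of the edge i → f i.  For x ∈ L
  -- the coordinates of these representatives contain x exactly for the colours x and f x, so their
  -- sum misses L.
  module PrivateSuccessors (K : Subset n) (successor : ∀ i → i ∈ K → ∃ (PrivateSuccessor K i)) where

    choice : ∀ i → Σ (Fin n × Fin m) λ (j , e) →
                   i ∈ K → c e ≡ j × i ∈ coords e × SourceIn (K - i) j
    choice i with i ∈? K
    ... | no  i∉K = (i , b i) , λ i∈K → ⊥-elim (i∉K i∈K)
    ... | yes i∈K with successor i i∈K
    ...   | j , (e , ce≡j , i∈e) , j-source = (j , e) , λ _ → ce≡j , i∈e , j-source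

    f : Fin n → Fin n
    f i = proj₁ (proj₁ (choice i))

    w : Fin n → Fin m
    w i = proj₂ (proj₁ (choice i))

    module _ {i} (i∈K : i ∈ K) where

      w-colour : c (w i) ≡ f i
      w-colour = proj₁ (proj₂ (choice i) i∈K)

      i∈coords-w : i ∈ coords (w i)
      i∈coords-w = proj₁ (proj₂ (proj₂ (choice i) i∈K))

      f-source : SourceIn (K - i) (f i)
      f-source = proj₂ (proj₂ (proj₂ (choice i) i∈K))

      f∈K : f i ∈ K
      f∈K = p─q⊆p K ⁅ i ⁆ (proj₁ f-source)

      f≢ : f i ≢ i
      f≢ = x∈p-y⇒x≢y (proj₁ f-source)

      f∈coords-w : f i ∈ coords (w i)
      f∈coords-w = subst (_∈ coords (w i)) w-colour (colour∈coords (w i))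

      coords-w-in-K : ∀ {x} → x ∈ K → x ∈ coords (w i) → x ≡ i ⊎ x ≡ f i
      coords-w-in-K {x} x∈K x∈ with x ≟ i
      ... | yes x≡i = inj₁ x≡i
      ... | no  x≢i = inj₂ (proj₂ f-source x (x∈p∧x≢y⇒x∈p-y x∈K x≢i) (w i , w-colour , x∈))

    f-injective : ∀ {i i′} → i ∈ K → i′ ∈ K → f i ≡ f i′ → i ≡ i′
    f-injective {i} {i′} i∈K i′∈K fi≡fi′ with i ≟ i′
    ... | yes i≡i′ = i≡i′
    ... | no  i≢i′ = ⊥-elim (f≢ i∈K (sym (trans i≡fi′ (sym fi≡fi′))))
      where
      i≡fi′ : i ≡ f i′
      i≡fi′ = proj₂ (f-source i′∈K) i (x∈p∧x≢y⇒x∈p-y i∈K i≢i′)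
                    (w i , trans (w-colour i∈K) fi≡fi′ , i∈coords-w i∈K)

    hit : ∀ l → Dec (∃ λ i → i ∈ K × f i ≡ l)
    hit l = any? λ i → i ∈? K ×-dec f i ≟ l

    L : Subset n
    L = tabulate λ l → ⌊ hit l ⌋

    pre : Fin n → Fin n
    pre l with hit l
    ... | yes (i , _) = i
    ... | no  _       = l

    pre-spec : ∀ {l} → l ∈ L → pre l ∈ K × f (pre l) ≡ l
    pre-spec {l} l∈L with hit l | ∈-tabulate⁻ l∈L
    ... | yes (i , i∈K , fi≡l) | _ = i∈K , fi≡l

    f∈L : ∀ {i} → i ∈ K → f i ∈ L
    f∈L i∈K = ∈-tabulate⁺ (Equivalence.to T-≡ (fromWitness (_ , i∈K , refl)))

    L⊆K : L ⊆ K
    L⊆K l∈L = let (i∈K , fi≡l) = pre-spec l∈L in subst (_∈ K) fi≡l (f∈K i∈K)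

    g : Fin n → Fin m
    g = patch L (w ∘ pre) b

    g-transversal : Transversal g
    g-transversal = patch-transversal w-pre-colour b-transversal
      where
      w-pre-colour : ∀ {l} → l ∈ L → c (w (pre l)) ≡ l
      w-pre-colour l∈L = let (i∈K , fi≡l) = pre-spec l∈L in trans (w-colour i∈K) fi≡l

    coords-w-bit : ∀ {i x} → i ∈ K → x ∈ K →
                   lookup (coords (w i)) x ≡ lookup ⁅ f i ⁆ (f x) xor lookup ⁅ f i ⁆ x
    coords-w-bit {i} {x} i∈K x∈K = begin
      lookup (coords (w i)) x                     ≡⟨ lookup-cong-∈ to from ⟩
      lookup (⁅ i ⁆ +ᵥ ⁅ f i ⁆) x                 ≡⟨ lookup-zipWith _xor_ x ⁅ i ⁆ ⁅ f i ⁆ ⟩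
      lookup ⁅ i ⁆ x xor lookup ⁅ f i ⁆ x
        ≡⟨ cong (_xor lookup ⁅ f i ⁆ x) (lookup-cong-∈ x≡i⇒fx≡fi fx≡fi⇒x≡i) ⟩
      lookup ⁅ f i ⁆ (f x) xor lookup ⁅ f i ⁆ x   ∎
      where
      open ≡-Reasoning
      x≡i⇒fx≡fi : x ∈ ⁅ i ⁆ → f x ∈ ⁅ f i ⁆
      x≡i⇒fx≡fi x∈ = subst (λ y → f y ∈ ⁅ f i ⁆) (sym (x∈⁅y⁆⇒x≡y i x∈)) (x∈⁅x⁆ (f i))
      fx≡fi⇒x≡i : f x ∈ ⁅ f i ⁆ → x ∈ ⁅ i ⁆
      fx≡fi⇒x≡i fx∈ = subst (_∈ ⁅ i ⁆) (sym (f-injective x∈K i∈K (x∈⁅y⁆⇒x≡y (f i) fx∈))) (x∈⁅x⁆ i)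
      to : x ∈ coords (w i) → x ∈ ⁅ i ⁆ +ᵥ ⁅ f i ⁆
      to x∈ with coords-w-in-K i∈K x∈K x∈
      ... | inj₁ refl = x∈p+ᵥq⁺ (inj₁ (x∈⁅x⁆ i , λ i∈ → f≢ i∈K (sym (x∈⁅y⁆⇒x≡y (f i) i∈))))
      ... | inj₂ refl = x∈p+ᵥq⁺ (inj₂ ((λ fi∈ → f≢ i∈K (x∈⁅y⁆⇒x≡y i fi∈)) , x∈⁅x⁆ (f i)))
      from : x ∈ ⁅ i ⁆ +ᵥ ⁅ f i ⁆ → x ∈ coords (w i)
      from x∈ with x∈p+ᵥq⁻ ⁅ i ⁆ ⁅ f i ⁆ x∈
      ... | inj₁ (x∈i , _) = subst (_∈ coords (w i)) (sym (x∈⁅y⁆⇒x≡y i x∈i)) (i∈coords-w i∈K)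
      ... | inj₂ (_ , x∈fi) = subst (_∈ coords (w i)) (sym (x∈⁅y⁆⇒x≡y (f i) x∈fi)) (f∈coords-w i∈K)

    coords-g-bit : ∀ {l x} → l ∈ L → x ∈ K →
                   lookup (coords (g l)) x ≡ lookup ⁅ l ⁆ (f x) xor lookup ⁅ l ⁆ x
    coords-g-bit {l} {x} l∈L x∈K = begin
      lookup (coords (g l)) x
        ≡⟨ cong (λ e → lookup (coords e) x) (patch-∈ {L} {w ∘ pre} {b} l∈L) ⟩
      lookup (coords (w (pre l))) x
        ≡⟨ coords-w-bit (proj₁ (pre-spec l∈L)) x∈K ⟩
      lookup ⁅ f (pre l) ⁆ (f x) xor lookup ⁅ f (pre l) ⁆ x
        ≡⟨ cong (λ l′ → lookup ⁅ l′ ⁆ (f x) xor lookup ⁅ l′ ⁆ x) (proj₂ (pre-spec l∈L)) ⟩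
      lookup ⁅ l ⁆ (f x) xor lookup ⁅ l ⁆ x
        ∎
      where open ≡-Reasoning

    coords-sum-misses : ∀ {x} → x ∈ L → x ∉ sumCols (coords ∘ g) L
    coords-sum-misses {x} x∈L x∈σ with trans (sym ([]=⇒lookup x∈σ)) parity≡false
      where
      open ≡-Reasoning
      parity≡false : lookup (sumCols (coords ∘ g) L) x ≡ false
      parity≡false = begin
        lookup (sumCols (coords ∘ g) L) x
          ≡⟨ lookup-sumCols (coords ∘ g) L x ⟩
        parity L (λ l → lookup (coords (g l)) x)
          ≡⟨ parity-cong L (λ l∈L → coords-g-bit l∈L (L⊆K x∈L)) ⟩
        parity L (λ l → lookup ⁅ l ⁆ (f x) xor lookup ⁅ l ⁆ x)
          ≡⟨ parity-xor _ _ L ⟩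
        parity L (λ l → lookup ⁅ l ⁆ (f x)) xor parity L (λ l → lookup ⁅ l ⁆ x)
          ≡⟨ cong₂ _xor_ (parity-⁅⁆ L (f x)) (parity-⁅⁆ L x) ⟩
        lookup L (f x) xor lookup L x
          ≡⟨ cong₂ _xor_ ([]=⇒lookup (f∈L (L⊆K x∈L))) ([]=⇒lookup x∈L) ⟩
        false
          ∎
    ... | ()

    impossible : Nonempty K → ⊥
    impossible (i , i∈K) = coords-sum-meets g-transversal (f i , f∈L i∈K) coords-sum-misses

  no-private-successors : ∀ K → Nonempty K → ¬ (∀ i → i ∈ K → ∃ (PrivateSuccessor K i))
  no-private-successors K K-nonempty successor = PrivateSuccessors.impossible K successor K-nonempty

  colour-sources : ∀ K → Nonempty K → ∃ (SourceIn K)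
  colour-sources = source-exists feeds? no-private-successors

  colour-sinks : ∀ K → Nonempty K → ∃ (SinkIn K)
  colour-sinks = sink-exists colour-sources

  source⇒parallelClass : ∀ {j} → SourceIn ⊤ j → ParallelClass A (ColourClass c j)
  source⇒parallelClass {j} (_ , only-j) =
    (b j , ∈-colourClass⁺ (b-transversal j)) , no-loop , pair-circuit , no-outside-circuit
    where
    X = ColourClass c j

    coords-X : ∀ {e} → c e ≡ j → coords e ≡ ⁅ j ⁆
    coords-X {e} ce≡j = ⊆-antisym
      (λ {i} i∈ → subst (_∈ ⁅ j ⁆) (sym (only-j i ∈⊤ (e , ce≡j , i∈))) (x∈⁅x⁆ j))
      (λ i∈ → subst (_∈ coords e) (trans ce≡j (sym (x∈⁅y⁆⇒x≡y j i∈))) (colour∈coords e))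

    column-X : ∀ {e} → e ∈ X → A e ≡ A (b j)
    column-X {e} e∈X = begin
      A e                ≡⟨ column≡lin-coords e ⟩
      lin (coords e)     ≡⟨ cong lin (coords-X (∈-colourClass⁻ e∈X)) ⟩
      lin ⁅ j ⁆          ≡⟨ sumCols-⁅⁆ (A ∘ b) j ⟩
      A (b j)            ∎
      where open ≡-Reasoning

    no-loop : ∀ e → e ∈ X → ¬ Loop A e
    no-loop e _ loop = achromatic ⁅ e ⁆ loop (singleton-rainbow e)

    pair-circuit : ∀ e f → e ∈ X → f ∈ X → e ≢ f → Circuit A (⁅ e ⁆ ∪ ⁅ f ⁆)
    pair-circuit e f e∈X f∈X e≢f =
      (⁅ e ⁆ ∪ ⁅ f ⁆ , ⊆-refl , (e , x∈p∪q⁺ (inj₁ (x∈⁅x⁆ e))) , pair-sum) , proper-independent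
      where
      disjoint : Empty (⁅ e ⁆ ∩ ⁅ f ⁆)
      disjoint (x , x∈) = let (x∈e , x∈f) = x∈p∩q⁻ ⁅ e ⁆ ⁅ f ⁆ x∈ in
        e≢f (trans (sym (x∈⁅y⁆⇒x≡y e x∈e)) (x∈⁅y⁆⇒x≡y f x∈f))
      pair-sum : sumCols A (⁅ e ⁆ ∪ ⁅ f ⁆) ≡ 0ᵥ
      pair-sum = begin
        sumCols A (⁅ e ⁆ ∪ ⁅ f ⁆)            ≡⟨ cong (sumCols A) (∪≡+ᵥ ⁅ e ⁆ ⁅ f ⁆ disjoint) ⟩
        sumCols A (⁅ e ⁆ +ᵥ ⁅ f ⁆)           ≡⟨ sumCols-additive A ⁅ e ⁆ ⁅ f ⁆ ⟩
        sumCols A ⁅ e ⁆ +ᵥ sumCols A ⁅ f ⁆   ≡⟨ cong₂ _+ᵥ_ (sumCols-⁅⁆ A e) (sumCols-⁅⁆ A f) ⟩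
        A e +ᵥ A f                           ≡⟨ cong₂ _+ᵥ_ (column-X e∈X) (column-X f∈X) ⟩
        A (b j) +ᵥ A (b j)                   ≡⟨ +ᵥ-same (A (b j)) ⟩
        0ᵥ                                   ∎
        where open ≡-Reasoning
      proper-independent : ∀ T → T ⊂ ⁅ e ⁆ ∪ ⁅ f ⁆ → Independent A T
      proper-independent T T⊂ =
        rainbow⇒independent A c achromatic (subsingleton⇒rainbow (⊂-pair⇒subsingleton T⊂))

    no-outside-circuit : ∀ e f → e ∈ X → f ∉ X → ¬ Circuit A (⁅ e ⁆ ∪ ⁅ f ⁆)
    no-outside-circuit e f e∈X f∉X circuit = achromatic _ circuit (pair-rainbow λ ce≡cf →
      ⊥-elim (f∉X (∈-colourClass⁺ (trans (sym ce≡cf) (∈-colourClass⁻ e∈X)))))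

  sink⇒cocircuit : ∀ {s} → SinkIn ⊤ s → Cocircuit A (ColourClass c s)
  sink⇒cocircuit {s} (_ , only-s) = meets-bases , minimal
    where
    X = ColourClass c s

    s∉coords : ∀ {e} → c e ≢ s → s ∉ coords e
    s∉coords {e} ce≢s s∈ = ce≢s (only-s (c e) ∈⊤ (e , refl , s∈))

    -- Adding b s to B creates a dependency U through b s.  Its coordinate sum vanishes, yet its
    -- s-th entry only counts b s, since no other element of U has colour s.
    disjoint-basis : ∀ {B} → Basis A B → Empty (X ∩ B) → ⊥
    disjoint-basis {B} (B-independent , B-maximal) misses with B-maximal (b s) bs∉B
      where
      bs∉B : b s ∉ B
      bs∉B bs∈B = misses (b s , x∈p∩q⁺ (∈-colourClass⁺ (b-transversal s) , bs∈B))
    ... | U , U⊆ , U-nonempty , U-sum = zero-sum⇒Empty[coords-sum] {U} U-sum (s , s∈σ)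
      where
      in-B : ∀ {x} → x ∈ U → x ≢ b s → x ∈ B
      in-B x∈U = x∈p∪⁅y⁆∧x≢y⇒x∈p (U⊆ x∈U)
      bs∈U : b s ∈ U
      bs∈U with b s ∈? U
      ... | yes bs∈U = bs∈U
      ... | no  bs∉U = ⊥-elim (B-independent (U , U⊆B , U-nonempty , U-sum))
        where
        U⊆B : U ⊆ B
        U⊆B x∈U = in-B x∈U λ { refl → bs∉U x∈U }
      bit : ∀ {x} → x ∈ U → lookup (coords x) s ≡ lookup ⁅ x ⁆ (b s)
      bit {x} x∈U = lookup-cong-∈ to from
        where
        to : s ∈ coords x → b s ∈ ⁅ x ⁆
        to s∈ with x ≟ b s
        ... | yes refl = x∈⁅x⁆ x
        ... | no  x≢bs = ⊥-elim (s∉coords cx≢s s∈)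
          where
          cx≢s : c x ≢ s
          cx≢s cx≡s = misses (x , x∈p∩q⁺ (∈-colourClass⁺ cx≡s , in-B x∈U x≢bs))
        from : b s ∈ ⁅ x ⁆ → s ∈ coords x
        from bs∈ = subst (_∈ coords x) cx≡s (colour∈coords x)
          where
          cx≡s : c x ≡ s
          cx≡s = trans (cong c (sym (x∈⁅y⁆⇒x≡y x bs∈))) (b-transversal s)
      s∈σ : s ∈ sumCols coords U
      s∈σ = lookup⇒[]= s _ (begin
        lookup (sumCols coords U) s              ≡⟨ lookup-sumCols coords U s ⟩
        parity U (λ x → lookup (coords x) s)     ≡⟨ parity-cong U bit ⟩
        parity U (λ x → lookup ⁅ x ⁆ (b s))      ≡⟨ parity-⁅⁆ U (b s) ⟩
        lookup U (b s)                           ≡⟨ []=⇒lookup bs∈U ⟩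
        true                                     ∎)
        where open ≡-Reasoning

    meets-bases : ∀ B → Basis A B → Nonempty (X ∩ B)
    meets-bases B B-basis with nonempty? (X ∩ B)
    ... | yes meets  = meets
    ... | no  misses = ⊥-elim (disjoint-basis B-basis misses)

    minimal : ∀ D → D ⊂ X → ∃ λ B → Basis A B × Empty (D ∩ B)
    minimal D (D⊆X , x , x∈X , x∉D) =
      image (through x) ⊤ , transversal-basis (through-transversal x) , avoids
      where
      avoids : Empty (D ∩ image (through x) ⊤)
      avoids (y , y∈) with x∈p∩q⁻ D (image (through x) ⊤) y∈
      ... | y∈D , y∈image = x∉D (subst (_∈ D) y≡x y∈D)
        where
        open ≡-Reasoning
        y≡x : y ≡ x
        y≡x = begin
          y                  ≡⟨ proj₁ (∈-image⁻ (through x) ⊤ y∈image) ⟨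
          through x (c y)    ≡⟨ cong (through x) (trans (∈-colourClass⁻ (D⊆X y∈D)) (sym (∈-colourClass⁻ x∈X))) ⟩
          through x (c x)    ≡⟨ through-colour x ⟩
          x                  ∎

corollary1 : ∀ {m k n : ℕ} (A : BinRep m k) (c : Fin m → Fin n)
    → 1 ≤ n
    → HasRank A n
    → Surjective c
    → CircuitAchromatic A c
    → (∃ λ i → ParallelClass A (ColourClass c i))
      × (∃ λ i → Cocircuit A (ColourClass c i))
corollary1 A c (s≤s _) rank surjective achromatic =
    map₂ source⇒parallelClass (colour-sources ⊤ (zero , ∈⊤))
  , map₂ sink⇒cocircuit (colour-sinks ⊤ (zero , ∈⊤))
  where open Achromatic A c rank surjective achromatic
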